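{- Let $\mathsf{C}$ be the set of one-hole contexts of the pure $\lambda$-calculus and let $\mathsf{ST}\subseteq\mathsf{C}$ be a strategy (a set of contexts). Suppose $\mathsf{ST}$ is uniform, i.e. for all $\mathcal{C}_1,\mathcal{C}_2\in\mathsf{C}$ we have $\mathcal{C}_1(\mathcal{C}_2)\in\mathsf{ST}$ if and only if $\mathcal{C}_1\in\mathsf{ST}$ and $\mathcal{C}_2\in\mathsf{ST}$. Then there is no strategy $\mathsf{SU}\subseteq\mathsf{C}$ with $\mathsf{SU}\neq\mathsf{ST}$ on which $\mathsf{ST}$ depends, where $\mathsf{ST}$ depends on $\mathsf{SU}$ means: there exists a context $\mathcal{C}_1\in\mathsf{ST}$ such that for every context $\mathcal{C}_2\in\mathsf{C}$, $\mathcal{C}_1(\mathcal{C}_2)\in\mathsf{ST}$ if and only if $\mathcal{C}_2\in\mathsf{SU}$. (In other words, uniformity of $\mathsf{ST}$ and dependence of $\mathsf{ST}$ on a different subsidiary strategy cannot hold simultaneously.)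
   Context: Terms of the pure $\lambda$-calculus: $\Lambda ::= x \mid \lambda x.\Lambda \mid \Lambda\,\Lambda$ over a countably infinite set of variables. A context is a term with exactly one hole $\Box$: $\mathsf{C} ::= \Box \mid \lambda x.\mathsf{C} \mid \mathsf{C}\,\Lambda \mid \Lambda\,\mathsf{C}$. For contexts $\mathcal{C}_1,\mathcal{C}_2$, $\mathcal{C}_1(\mathcal{C}_2)$ denotes the context obtained by replacing the hole of $\mathcal{C}_1$ by $\mathcal{C}_2$ (no care for variable capture). A strategy is identified with a set of contexts (the contexts in which it locates the next redex to contract). -}

module Defs where

open import Level using (Level; _⊔_; suc)
open import Data.Nat using (ℕ)
open import Data.Product using (Σ; _×_)
open import Relation.Nullary using (¬_)
open import Function.Bundles using (_⇔_)

Var : Set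
Var = ℕ

-- Terms of the pure λ-calculus (named variables, no quotient by α).
data Λ : Set where
  var : Var → Λ
  lam : Var → Λ → Λ
  app : Λ → Λ → Λ

data Ctx : Set where
  □    : Ctx
  lamC : Var → Ctx → Ctx
  appL : Ctx → Λ → Ctx
  appR : Λ → Ctx → Ctx

-- Context composition C₁(C₂): replace the hole of C₁ by C₂ (capturing).
_⟨_⟩ : Ctx → Ctx → Ctx
□          ⟨ D ⟩ = D
lamC x C   ⟨ D ⟩ = lamC x (C ⟨ D ⟩)
appL C t   ⟨ D ⟩ = appL (C ⟨ D ⟩) t
appR t C   ⟨ D ⟩ = appR t (C ⟨ D ⟩)

Strategy : (ℓ : Level) → Set (suc ℓ)
Strategy ℓ = Ctx → Set ℓ

_≐_ : {ℓ₁ ℓ₂ : Level} → Strategy ℓ₁ → Strategy ℓ₂ → Set (ℓ₁ ⊔ ℓ₂)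
S ≐ T = ∀ C → S C ⇔ T C

Uniform : {ℓ : Level} → Strategy ℓ → Set ℓ
Uniform ST = ∀ C₁ C₂ → ST (C₁ ⟨ C₂ ⟩) ⇔ (ST C₁ × ST C₂)

DependsOn : {ℓ₁ ℓ₂ : Level} → Strategy ℓ₁ → Strategy ℓ₂ → Set (ℓ₁ ⊔ ℓ₂)
DependsOn ST SU = Σ Ctx (λ C₁ → ST C₁ × (∀ C₂ → ST (C₁ ⟨ C₂ ⟩) ⇔ SU C₂))

module Submission where

open import Defs
open import Level using (Level)
open import Data.Product using (Σ; _×_; _,_; proj₂)
open import Relation.Nullary using (¬_)
open import Function.Bundles using (mk⇔; Equivalence)

-- Uniformity at a fixed C₁ ∈ ST says that C₁(C₂) ∈ ST iff C₂ ∈ ST,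
-- so the only strategy ST can depend on is ST itself.
dependsOn-uniform⇒≐ : {ℓ₁ ℓ₂ : Level} (ST : Strategy ℓ₁) (SU : Strategy ℓ₂) →
                      Uniform ST → DependsOn ST SU → SU ≐ ST
dependsOn-uniform⇒≐ ST SU uniform (C₁ , C₁∈ST , dep) C₂ =
  mk⇔ (λ C₂∈SU → proj₂ (Equivalence.to (uniform C₁ C₂) (Equivalence.from (dep C₂) C₂∈SU)))
      (λ C₂∈ST → Equivalence.to (dep C₂) (Equivalence.from (uniform C₁ C₂) (C₁∈ST , C₂∈ST)))

proposition7p3 : {ℓ : Level} (ST : Strategy ℓ) → Uniform ST →
    ¬ (Σ (Strategy ℓ) (λ SU → ¬ (SU ≐ ST) × DependsOn ST SU))
proposition7p3 ST uniform (SU , SU≉ST , dep) = SU≉ST (dependsOn-uniform⇒≐ ST SU uniform dep)
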